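{- For every $n\ge1$, \[ B_n^{\pm}(s,t)=\begin{cases}B_n^{\pm}(t,s)&\text{if } n \text{ is even},\\ B_n^{\mp}(t,s)&\text{if } n\text{ is odd}.\end{cases} \]
   Context: $B_n$ is the group of bijections $w$ of $\{ -n,\dots,n\}$ with $w(-i)=-w(i)$, written $w=w(1)\cdots w(n)$, with $w(0)=0$. $\mathrm{des}_B(w)=|\{0\le i\le n-1:w(i)>w(i+1)\}|$ and $\mathrm{asc}_B(w)=n-\mathrm{des}_B(w)$. Writing $w=u^J$ with $u\in S_n$, $J\subseteq[n]$ (meaning $w(j)=u(j)$ for $j\notin J$, $w(j)=-u(j)$ for $j\in J$), the sign is $\mathrm{sgn}_B(w)=(-1)^{|J|}\mathrm{sgn}(u)$. $B_n^{\pm}=\{w\in B_n:\mathrm{sgn}_B(w)=\pm1\}$ and $B_n^{\pm}(s,t)=\sum_{w\in B_n^{\pm}}s^{\mathrm{asc}_B(w)}t^{\mathrm{des}_B(w)}$. The statement is read with all upper or all lower signs simultaneously. -}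

module Defs where

open import Level using (Level)
open import Data.Bool using (Bool; true; false; if_then_else_; not; _∧_; _xor_)
open import Data.Nat as ℕ using (ℕ; zero; suc)
open import Data.Integer as ℤ using (ℤ; +_; -_; ∣_∣)
open import Data.List using (List; []; _∷_; map; _++_; concatMap; filterᵇ; length; upTo)
open import Relation.Nullary.Decidable using (⌊_⌋)
open import Algebra.Bundles using (CommutativeSemiring)

-- Signed permutations of [n], written in one-line notation w = w(1) ⋯ w(n)
-- as a list of n integers.

signedValues : ℕ → List ℤ
signedValues n = map (λ i → + suc i) (upTo n) ++ map (λ i → - (+ suc i)) (upTo n)

words : {A : Set} → List A → ℕ → List (List A)
words xs zero    = [] ∷ []
words xs (suc k) = concatMap (λ x → map (x ∷_) (words xs k)) xs

allB : {A : Set} → (A → Bool) → List A → Bool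
allB p []       = true
allB p (x ∷ xs) = p x ∧ allB p xs

absDistinct : List ℤ → Bool
absDistinct []       = true
absDistinct (x ∷ xs) = allB (λ y → not ⌊ ∣ x ∣ ℕ.≟ ∣ y ∣ ⌋) xs ∧ absDistinct xs

-- the hyperoctahedral group B_n, enumerated as a list without repetitions
B : ℕ → List (List ℤ)
B n = filterᵇ absDistinct (words (signedValues n) n)

descents : List ℤ → ℕ
descents []           = 0
descents (x ∷ [])     = 0
descents (x ∷ y ∷ xs) = (if ⌊ y ℤ.<? x ⌋ then 1 else 0) ℕ.+ descents (y ∷ xs)

desB : List ℤ → ℕ
desB w = descents (+ 0 ∷ w)

ascB : List ℤ → ℕ
ascB w = length w ℕ.∸ desB w

negCount : List ℤ → ℕ
negCount []       = 0
negCount (x ∷ xs) = (if ⌊ x ℤ.<? + 0 ⌋ then 1 else 0) ℕ.+ negCount xs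

inversions : List ℕ → ℕ
inversions []       = 0
inversions (x ∷ xs) = length (filterᵇ (λ y → ⌊ y ℕ.<? x ⌋) xs) ℕ.+ inversions xs

isEven : ℕ → Bool
isEven zero          = true
isEven (suc zero)    = false
isEven (suc (suc n)) = isEven n

-- sgn_B(w) = (-1)^{|J|} sgn(u), with u = |w| ∈ S_n and sgn(u) = (-1)^{inv(u)}.
-- Encoded as a Bool: true ↔ sgn_B(w) = +1, false ↔ sgn_B(w) = -1.
sgnB : List ℤ → Bool
sgnB w = isEven (negCount w ℕ.+ inversions (map ∣_∣ w))

module _ {c ℓ : Level} (R : CommutativeSemiring c ℓ) where
  open CommutativeSemiring R

  pow : Carrier → ℕ → Carrier
  pow x zero    = 1#
  pow x (suc k) = x * pow x k

  sumR : List Carrier → Carrier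
  sumR []       = 0#
  sumR (x ∷ xs) = x + sumR xs

  -- B_n^{σ}(s,t) = Σ_{w ∈ B_n, sgn_B(w) = σ} s^{asc_B(w)} t^{des_B(w)}
  -- (σ = true means '+', σ = false means '-'), evaluated in R.
  Bpoly : Bool → ℕ → Carrier → Carrier → Carrier
  Bpoly σ n s t =
    sumR (map (λ w → pow s (ascB w) * pow t (desB w))
              (filterᵇ (λ w → not (sgnB w xor σ)) (B n)))

module Submission where

-- Negation w ↦ −w permutes B_n. Of each of the n adjacent pairs of 0 w(1) ⋯ w(n),
-- exactly one is a descent in w or in −w, so des_B(−w) = asc_B(w) and
-- asc_B(−w) = des_B(w). Negation replaces J by its complement and leaves |w| ∈ S_n
-- unchanged, so it multiplies sgn_B by (−1)^n. Reindexing the sum by w ↦ −w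
-- gives the identity.

open import Defs
open import Level using (Level)
open import Data.Bool using (Bool; true; false; if_then_else_; not; _∧_; _xor_; T)
open import Data.Bool.Properties using (xor-assoc; xor-comm; xor-inverseˡ; T-∧)
open import Data.Nat as ℕ using (ℕ; _≤_; zero; suc)
open import Data.Nat.Properties using (m+n∸n≡m; m+n∸m≡n; +-commutativeSemigroup)
import Algebra.Properties.CommutativeSemigroup as CommutativeSemigroupProperties
open import Data.Integer as ℤ using (ℤ; +_; -_; ∣_∣)
open import Data.Integer.Properties using (neg-involutive; neg-mono-<; ∣-i∣≡∣i∣; <-asym; <-cmp)
open import Data.List using (List; []; _∷_; map; _++_; concatMap; filterᵇ; foldr; length; upTo)
open import Data.List.Properties using (map-∘; map-cong; map-++; length-map; concatMap-map; map-concatMap; concatMap-cong)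
open import Data.List.Relation.Unary.All as All using (All; []; _∷_)
open import Data.List.Relation.Unary.All.Properties using (concat⁺; gmap⁺; filter⁺; all-filter) renaming (++⁺ to All-++⁺; map⁺ to All-map⁺)
open import Data.List.Relation.Unary.Linked using (Linked; []; [-]; _∷_)
open import Data.List.Relation.Binary.Permutation.Propositional
  using (_↭_; refl; prep; swap; trans; ↭-sym; ↭⇒↭ₛ′)
open import Data.List.Relation.Binary.Permutation.Propositional.Properties
  using (++⁺; ++⁺ˡ; ++-comm; shifts; map⁺; filter-↭)
import Data.List.Relation.Binary.Permutation.Setoid.Properties as SetoidPermutation
open import Data.Product using (_×_; _,_; proj₁; proj₂)
open import Data.Empty using (⊥-elim)
open import Function using (_∘_; Equivalence)
open import Relation.Nullary using (yes; no)
open import Relation.Nullary.Decidable using (⌊_⌋; T?; toWitnessFalse)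
open import Relation.Binary.Definitions using (tri<; tri≈; tri>)
open import Relation.Binary.PropositionalEquality
  using (_≡_; _≢_; refl; cong; cong₂; subst; module ≡-Reasoning)
  renaming (sym to ≡-sym; trans to ≡-trans)
open import Algebra.Bundles using (CommutativeSemiring)

isEven-suc : ∀ n → isEven (suc n) ≡ not (isEven n)
isEven-suc zero          = refl
isEven-suc (suc zero)    = refl
isEven-suc (suc (suc n)) = isEven-suc n

isEven-+ : ∀ m n → isEven (m ℕ.+ n) ≡ not (isEven m) xor isEven n
isEven-+ zero          n = refl
isEven-+ (suc zero)    n = isEven-suc n
isEven-+ (suc (suc m)) n = isEven-+ m n

isEven-double-+ : ∀ k m → isEven ((k ℕ.+ k) ℕ.+ m) ≡ isEven m
isEven-double-+ k m = ≡-trans (isEven-+ (k ℕ.+ k) m)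
  (cong (λ b → not b xor isEven m) (≡-trans (isEven-+ k k) (xor-inverseˡ (isEven k))))

filterᵇ-map : ∀ {A C : Set} (p : C → Bool) (f : A → C) (xs : List A) →
              filterᵇ p (map f xs) ≡ map f (filterᵇ (p ∘ f) xs)
filterᵇ-map p f []       = refl
filterᵇ-map p f (x ∷ xs) with p (f x)
... | true  = cong (f x ∷_) (filterᵇ-map p f xs)
... | false = filterᵇ-map p f xs

filterᵇ-cong : ∀ {A : Set} {p q : A → Bool} {xs : List A} →
               All (λ x → p x ≡ q x) xs → filterᵇ p xs ≡ filterᵇ q xs
filterᵇ-cong []                                = refl
filterᵇ-cong {p = p} {q} {x ∷ xs} (px≡qx ∷ eqs) with p x | q x
... | true  | true  = cong (x ∷_) (filterᵇ-cong eqs)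
... | false | false = filterᵇ-cong eqs
... | true  | false with () ← px≡qx
... | false | true  with () ← px≡qx

concatMap-cong-↭ : ∀ {A C : Set} {f g : A → List C} (xs : List A) →
                   (∀ x → f x ↭ g x) → concatMap f xs ↭ concatMap g xs
concatMap-cong-↭ []       f↭g = refl
concatMap-cong-↭ (x ∷ xs) f↭g = ++⁺ (f↭g x) (concatMap-cong-↭ xs f↭g)

concatMap-↭ : ∀ {A C : Set} (f : A → List C) {xs ys : List A} →
              xs ↭ ys → concatMap f xs ↭ concatMap f ys
concatMap-↭ f refl          = refl
concatMap-↭ f (prep x p)    = ++⁺ˡ (f x) (concatMap-↭ f p)
concatMap-↭ f (swap x y p)  = trans (shifts (f x) (f y)) (++⁺ˡ (f y) (++⁺ˡ (f x) (concatMap-↭ f p)))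
concatMap-↭ f (trans p q)   = trans (concatMap-↭ f p) (concatMap-↭ f q)

words-map : ∀ {A C : Set} (g : A → C) (xs : List A) k →
            words (map g xs) k ≡ map (map g) (words xs k)
words-map g xs zero    = refl
words-map g xs (suc k) = begin
  concatMap (λ y → map (y ∷_) (words (map g xs) k)) (map g xs)
    ≡⟨ concatMap-map _ g xs ⟩
  concatMap (λ x → map (g x ∷_) (words (map g xs) k)) xs
    ≡⟨ concatMap-cong (λ x → cong (map (g x ∷_)) (words-map g xs k)) xs ⟩
  concatMap (λ x → map (g x ∷_) (map (map g) (words xs k))) xs
    ≡⟨ concatMap-cong (λ x → ≡-trans (≡-sym (map-∘ (words xs k))) (map-∘ (words xs k))) xs ⟩
  concatMap (λ x → map (map g) (map (x ∷_) (words xs k))) xs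
    ≡⟨ map-concatMap (map g) _ xs ⟨
  map (map g) (concatMap (λ x → map (x ∷_) (words xs k)) xs) ∎
  where open ≡-Reasoning

words-↭ : ∀ {A : Set} {xs ys : List A} k → xs ↭ ys → words xs k ↭ words ys k
words-↭         zero    p = refl
words-↭ {xs = xs} (suc k) p =
  trans (concatMap-cong-↭ xs (λ x → map⁺ (x ∷_) (words-↭ k p))) (concatMap-↭ _ p)

All-words : ∀ {A : Set} {P : A → Set} {xs : List A} k →
            All P xs → All (λ w → length w ≡ k × All P w) (words xs k)
All-words zero    pxs = (refl , []) ∷ []
All-words (suc k) pxs = concat⁺ (gmap⁺ (λ px →
  gmap⁺ (λ (len , pw) → cong suc len , px ∷ pw) (All-words k pxs)) pxs)

negate : List ℤ → List ℤ
negate = map -_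

<-neg-<-exclusive : ∀ {x y} → x ≢ y →
  (if ⌊ y ℤ.<? x ⌋ then 1 else 0) ℕ.+ (if ⌊ - y ℤ.<? - x ⌋ then 1 else 0) ≡ 1
<-neg-<-exclusive {x} {y} x≢y with y ℤ.<? x | - y ℤ.<? - x
... | yes y<x | yes -y<-x = ⊥-elim (<-asym (neg-mono-< y<x) -y<-x)
... | yes _   | no  _     = refl
... | no  _   | yes _     = refl
... | no  y≮x | no  -y≮-x with <-cmp x y
...   | tri< x<y _   _   = ⊥-elim (-y≮-x (neg-mono-< x<y))
...   | tri≈ _   x≡y _   = ⊥-elim (x≢y x≡y)
...   | tri> _   _   y<x = ⊥-elim (y≮x y<x)

private
  interchange : ∀ a b c d → (a ℕ.+ b) ℕ.+ (c ℕ.+ d) ≡ (a ℕ.+ c) ℕ.+ (b ℕ.+ d)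
  interchange = CommutativeSemigroupProperties.interchange +-commutativeSemigroup

descents-negate : ∀ {v} → Linked _≢_ v → descents v ℕ.+ descents (negate v) ≡ ℕ.pred (length v)
descents-negate []                = refl
descents-negate [-]               = refl
descents-negate {x ∷ y ∷ v} (x≢y ∷ linked) = ≡-trans
  (interchange (if ⌊ y ℤ.<? x ⌋ then 1 else 0) (descents (y ∷ v))
               (if ⌊ - y ℤ.<? - x ⌋ then 1 else 0) (descents (negate (y ∷ v))))
  (cong₂ ℕ._+_ (<-neg-<-exclusive x≢y) (descents-negate linked))

negCount-negate : ∀ {w} → All (+ 0 ≢_) w → negCount w ℕ.+ negCount (negate w) ≡ length w
negCount-negate                []           = refl
negCount-negate {x ∷ w} (0≢x ∷ nonzero) = ≡-trans
  (interchange (if ⌊ x ℤ.<? + 0 ⌋ then 1 else 0) (negCount w)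
               (if ⌊ - x ℤ.<? + 0 ⌋ then 1 else 0) (negCount (negate w)))
  (cong₂ ℕ._+_ (<-neg-<-exclusive 0≢x) (negCount-negate nonzero))

absDistinct-negate : ∀ w → absDistinct (negate w) ≡ absDistinct w
absDistinct-negate []       = refl
absDistinct-negate (x ∷ w) = cong₂ _∧_ (allB-negate w) (absDistinct-negate w)
  where
  allB-negate : ∀ v → allB (λ y → not ⌊ ∣ - x ∣ ℕ.≟ ∣ y ∣ ⌋) (negate v)
                    ≡ allB (λ y → not ⌊ ∣ x ∣ ℕ.≟ ∣ y ∣ ⌋) v
  allB-negate []       = refl
  allB-negate (y ∷ v) = cong₂ _∧_
    (cong₂ (λ a b → not ⌊ a ℕ.≟ b ⌋) (∣-i∣≡∣i∣ x) (∣-i∣≡∣i∣ y)) (allB-negate v)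

absDistinct⇒Linked : ∀ w → T (absDistinct w) → Linked _≢_ w
absDistinct⇒Linked []          _        = []
absDistinct⇒Linked (x ∷ [])    _        = [-]
absDistinct⇒Linked (x ∷ y ∷ w) distinct =
  let x-distinct , rest-distinct =
        Equivalence.to (T-∧ {allB (λ z → not ⌊ ∣ x ∣ ℕ.≟ ∣ z ∣ ⌋) (y ∷ w)}) distinct
  in toWitnessFalse (proj₁ (Equivalence.to (T-∧ {not ⌊ ∣ x ∣ ℕ.≟ ∣ y ∣ ⌋}) x-distinct)) ∘ cong ∣_∣
     ∷ absDistinct⇒Linked (y ∷ w) rest-distinct

-- All that the argument uses about an element w of B_n.
SignedWord : ℕ → List ℤ → Set
SignedWord n w = length w ≡ n × All (+ 0 ≢_) w × Linked _≢_ (+ 0 ∷ w)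

B-signedWord : ∀ n → All (SignedWord n) (B n)
B-signedWord n = All.zipWith signedWord
  ( all-filter (T? ∘ absDistinct) (words (signedValues n) n)
  , filter⁺ (T? ∘ absDistinct) (All-words n signedValues-nonzero))
  where
  signedValues-nonzero : All (+ 0 ≢_) (signedValues n)
  signedValues-nonzero = All-++⁺ (All-map⁺ (All.universal (λ _ ()) (upTo n)))
                                 (All-map⁺ (All.universal (λ _ ()) (upTo n)))
  signedWord : ∀ {w} → T (absDistinct w) × (length w ≡ n × All (+ 0 ≢_) w) → SignedWord n w
  signedWord {[]}    (_        , len , [])          = len , [] , [-]
  signedWord {x ∷ w} (distinct , len , 0≢x ∷ nonzero) =
    len , 0≢x ∷ nonzero , 0≢x ∷ absDistinct⇒Linked (x ∷ w) distinct

signedValues-negate : ∀ n → map -_ (signedValues n) ↭ signedValues n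
signedValues-negate n = subst (_↭ positive ++ negative) (≡-sym negate-swaps) (++-comm negative positive)
  where
  positive negative : List ℤ
  positive = map (λ i → + suc i) (upTo n)
  negative = map (λ i → - (+ suc i)) (upTo n)
  negate-swaps : map -_ (positive ++ negative) ≡ negative ++ positive
  negate-swaps = ≡-trans (map-++ -_ positive negative)
    (cong₂ _++_ (≡-sym (map-∘ (upTo n)))
                (≡-trans (≡-sym (map-∘ (upTo n))) (map-cong (λ i → neg-involutive (+ suc i)) (upTo n))))

B-negate : ∀ n → map negate (B n) ↭ B n
B-negate n = subst (_↭ B n) (≡-sym commute) (filter-↭ (T? ∘ absDistinct) (words-↭ n (signedValues-negate n)))
  where
  commute : map negate (B n) ≡ filterᵇ absDistinct (words (map -_ (signedValues n)) n)
  commute = begin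
    map negate (filterᵇ absDistinct W)
      ≡⟨ cong (map negate) (filterᵇ-cong (All.universal (≡-sym ∘ absDistinct-negate) W)) ⟩
    map negate (filterᵇ (absDistinct ∘ negate) W)
      ≡⟨ filterᵇ-map absDistinct negate W ⟨
    filterᵇ absDistinct (map negate W)
      ≡⟨ cong (filterᵇ absDistinct) (words-map -_ (signedValues n) n) ⟨
    filterᵇ absDistinct (words (map -_ (signedValues n)) n) ∎
    where
    W : List (List ℤ)
    W = words (signedValues n) n
    open ≡-Reasoning

module _ {n : ℕ} {w : List ℤ} (signed : SignedWord n w) where
  private
    len : length w ≡ n
    len = proj₁ signed
    nonzero : All (+ 0 ≢_) w
    nonzero = proj₁ (proj₂ signed)
    linked : Linked _≢_ (+ 0 ∷ w)
    linked = proj₂ (proj₂ signed)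

  desB-+-desB-negate : desB w ℕ.+ desB (negate w) ≡ n
  desB-+-desB-negate = ≡-trans (descents-negate linked) len

  ascB-negate : ascB (negate w) ≡ desB w
  ascB-negate = ≡-trans
    (cong (ℕ._∸ desB (negate w)) (≡-trans (length-map -_ w) (≡-trans len (≡-sym desB-+-desB-negate))))
    (m+n∸n≡m (desB w) (desB (negate w)))

  desB-negate : desB (negate w) ≡ ascB w
  desB-negate = ≡-trans (≡-sym (m+n∸m≡n (desB w) (desB (negate w))))
    (cong (ℕ._∸ desB w) (≡-trans desB-+-desB-negate (≡-sym len)))

  -- Negation complements J, so |J| + |J′| = n; adding the even number 2|J| to |J′| + inv
  -- therefore gives n + (|J| + inv).
  sgnB-negate : sgnB (negate w) ≡ not (isEven n) xor sgnB w
  sgnB-negate = begin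
    isEven (a′ ℕ.+ inversions (map ∣_∣ (negate w)))
      ≡⟨ cong (λ v → isEven (a′ ℕ.+ inversions v)) abs-negate ⟩
    isEven (a′ ℕ.+ i)
      ≡⟨ isEven-double-+ a (a′ ℕ.+ i) ⟨
    isEven ((a ℕ.+ a) ℕ.+ (a′ ℕ.+ i))
      ≡⟨ cong isEven (interchange a a a′ i) ⟩
    isEven ((a ℕ.+ a′) ℕ.+ (a ℕ.+ i))
      ≡⟨ cong (λ m → isEven (m ℕ.+ (a ℕ.+ i))) (≡-trans (negCount-negate nonzero) len) ⟩
    isEven (n ℕ.+ (a ℕ.+ i))
      ≡⟨ isEven-+ n (a ℕ.+ i) ⟩
    not (isEven n) xor sgnB w ∎
    where
    open ≡-Reasoning
    a a′ i : ℕ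
    a  = negCount w
    a′ = negCount (negate w)
    i  = inversions (map ∣_∣ w)
    abs-negate : map ∣_∣ (negate w) ≡ map ∣_∣ w
    abs-negate = ≡-trans (≡-sym (map-∘ w)) (map-cong ∣-i∣≡∣i∣ w)

hasSign : Bool → List ℤ → Bool
hasSign σ w = not (sgnB w xor σ)

hasSign-negate : ∀ {n w} σ → SignedWord n w → hasSign σ (negate w) ≡ hasSign (not (isEven n) xor σ) w
hasSign-negate {n} {w} σ signed = cong not (begin
  sgnB (negate w) xor σ                    ≡⟨ cong (_xor σ) (sgnB-negate signed) ⟩
  (not (isEven n) xor sgnB w) xor σ        ≡⟨ cong (_xor σ) (xor-comm (not (isEven n)) (sgnB w)) ⟩
  (sgnB w xor not (isEven n)) xor σ        ≡⟨ xor-assoc (sgnB w) (not (isEven n)) σ ⟩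
  sgnB w xor (not (isEven n) xor σ)        ∎)
  where open ≡-Reasoning

module _ {c ℓ : Level} (R : CommutativeSemiring c ℓ) where
  open CommutativeSemiring R
    using (Carrier; _≈_; _+_; _*_; 0#; +-cong; *-comm; setoid; isEquivalence; +-isCommutativeMonoid)
    renaming (refl to ≈-refl)
  open import Relation.Binary.Reasoning.Setoid setoid

  sumR≡foldr : ∀ xs → sumR R xs ≡ foldr _+_ 0# xs
  sumR≡foldr []       = refl
  sumR≡foldr (x ∷ xs) = cong (_+_ x) (sumR≡foldr xs)

  sumR-↭ : ∀ {xs ys} → xs ↭ ys → sumR R xs ≈ sumR R ys
  sumR-↭ {xs} {ys} xs↭ys = begin
    sumR R xs         ≡⟨ sumR≡foldr xs ⟩
    foldr _+_ 0# xs   ≈⟨ SetoidPermutation.foldr-commMonoid setoid +-isCommutativeMonoid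
                           (↭⇒↭ₛ′ isEquivalence xs↭ys) ⟩
    foldr _+_ 0# ys   ≡⟨ sumR≡foldr ys ⟨
    sumR R ys         ∎

  sumR-map-cong : ∀ {A : Set} {f g : A → Carrier} {xs : List A} →
                  All (λ x → f x ≈ g x) xs → sumR R (map f xs) ≈ sumR R (map g xs)
  sumR-map-cong []           = ≈-refl
  sumR-map-cong (fx≈gx ∷ eqs) = +-cong fx≈gx (sumR-map-cong eqs)

  sumR-filter-reindex : ∀ {A : Set} {f : A → A} {xs : List A} → map f xs ↭ xs →
    (g : A → Carrier) (p : A → Bool) →
    sumR R (map g (filterᵇ p xs)) ≈ sumR R (map (g ∘ f) (filterᵇ (p ∘ f) xs))
  sumR-filter-reindex {f = f} {xs} f-perm g p = begin
    sumR R (map g (filterᵇ p xs))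
      ≈⟨ sumR-↭ (map⁺ g (filter-↭ (T? ∘ p) (↭-sym f-perm))) ⟩
    sumR R (map g (filterᵇ p (map f xs)))
      ≡⟨ cong (sumR R ∘ map g) (filterᵇ-map p f xs) ⟩
    sumR R (map g (map f (filterᵇ (p ∘ f) xs)))
      ≡⟨ cong (sumR R) (map-∘ (filterᵇ (p ∘ f) xs)) ⟨
    sumR R (map (g ∘ f) (filterᵇ (p ∘ f) xs)) ∎

  ascDesMonomial : Carrier → Carrier → List ℤ → Carrier
  ascDesMonomial s t w = pow R s (ascB w) * pow R t (desB w)

  ascDesMonomial-negate : ∀ {n w} s t → SignedWord n w →
                          ascDesMonomial s t (negate w) ≈ ascDesMonomial t s w
  ascDesMonomial-negate {w = w} s t signed = begin
    pow R s (ascB (negate w)) * pow R t (desB (negate w))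
      ≡⟨ cong₂ (λ i j → pow R s i * pow R t j) (ascB-negate signed) (desB-negate signed) ⟩
    pow R s (desB w) * pow R t (ascB w)
      ≈⟨ *-comm (pow R s (desB w)) (pow R t (ascB w)) ⟩
    pow R t (ascB w) * pow R s (desB w) ∎

  Bpoly-swap : ∀ σ n s t → Bpoly R σ n s t ≈ Bpoly R (not (isEven n) xor σ) n t s
  Bpoly-swap σ n s t = begin
    sumR R (map (ascDesMonomial s t) (filterᵇ (hasSign σ) (B n)))
      ≈⟨ sumR-filter-reindex (B-negate n) (ascDesMonomial s t) (hasSign σ) ⟩
    sumR R (map (ascDesMonomial s t ∘ negate) (filterᵇ (hasSign σ ∘ negate) (B n)))
      ≡⟨ cong (sumR R ∘ map (ascDesMonomial s t ∘ negate))
              (filterᵇ-cong (All.map (hasSign-negate σ) (B-signedWord n))) ⟩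
    sumR R (map (ascDesMonomial s t ∘ negate) (filterᵇ (hasSign σ′) (B n)))
      ≈⟨ sumR-map-cong (All.map (ascDesMonomial-negate s t)
                                (filter⁺ (T? ∘ hasSign σ′) (B-signedWord n))) ⟩
    sumR R (map (ascDesMonomial t s) (filterᵇ (hasSign σ′) (B n))) ∎
    where
    σ′ : Bool
    σ′ = not (isEven n) xor σ

proposition5p4 : {c ℓ : Level} (R : CommutativeSemiring c ℓ) (n : ℕ) → 1 ≤ n → (σ : Bool) → (s t : CommutativeSemiring.Carrier R) →
    CommutativeSemiring._≈_ R (Bpoly R σ n s t) (if isEven n then Bpoly R σ n t s else Bpoly R (not σ) n t s)
proposition5p4 R n _ σ s t =
  CommutativeSemiring.trans R (Bpoly-swap R σ n s t) (CommutativeSemiring.reflexive R (by-parity (isEven n)))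
  where
  by-parity : ∀ e → Bpoly R (not e xor σ) n t s ≡ (if e then Bpoly R σ n t s else Bpoly R (not σ) n t s)
  by-parity true  = refl
  by-parity false = refl
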